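{- There is a constant $c>0$ such that for every $n\ge 4$, every rectangular layout (on the integer grid) of an $(n,n)$-ladder has area at least $c\,n^2$.
   Context: An $m$-rung ladder is a graph containing distinct vertices $L,R$ (struts) and $x_1,\dots,x_m$ (rungs) with edges $\{L,x_i\},\{x_i,R\}$ for all $i$ and, for each $1\le i<m$, a path (possibly through further vertices) from $x_i$ to $x_{i+1}$. An $(i,j)$-ladder is a graph on exactly $i+j+2$ vertices $L,R,x_1,\dots,x_i,y_1,\dots,y_j$ that is the union of an $i$-rung ladder with struts $L,R$ and rungs $x_1,\dots,x_i$ and a $j$-rung ladder with struts $x_{\lfloor i/2\rfloor}, x_{\lfloor i/2\rfloor+1}$ and rungs $y_1,\dots,y_j$. A (strong) rectangular layout of a graph is a set of axis-parallel rectangles with pairwise disjoint interiors, one per vertex, such that two rectangles' boundaries share a segment of positive length if and only if the corresponding vertices are adjacent; on the integer grid all corners are integral, and the area is that of the smallest enclosing axis-parallel bounding box. -}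

module Defs where

open import Data.Nat as ℕ using (ℕ; suc; _/_)
open import Data.Fin using (Fin; toℕ)
open import Data.List using (List; _∷_; []; map; _++_; foldr; allFin)
open import Data.List.Relation.Unary.Unique.Propositional using (Unique)
open import Data.List.Relation.Unary.Linked using (Linked)
open import Data.List.Relation.Unary.All using (All)
open import Data.Integer as ℤ using (ℤ; _⊓_; _⊔_)
open import Data.Product using (Σ; ∃; _×_; _,_)
open import Data.Sum using (_⊎_)
open import Data.Maybe using (just)
open import Data.List using (head; last)
open import Relation.Binary.PropositionalEquality using (_≡_; _≢_)
open import Relation.Nullary using (¬_)
open import Function.Bundles using (_⇔_)

record Graph (V : Set) : Set₁ where
  field
    Adj     : V → V → Set
    sym     : ∀ {u v} → Adj u v → Adj v u
    irrefl  : ∀ {u} → ¬ Adj u u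

record Path {V : Set} (E : V → V → Set) (a b : V) : Set where
  field
    verts    : List V
    starts   : head verts ≡ just a
    ends     : last verts ≡ just b
    linked   : Linked E verts
    distinct : Unique verts

-- Vertices of an (i,j)-ladder: L, R, x₁..xᵢ, y₁..yⱼ.
-- x k (k : Fin i) stands for x_{toℕ k + 1}; likewise for y.

data LV (i j : ℕ) : Set where
  L R : LV i j
  x   : Fin i → LV i j
  y   : Fin j → LV i j

allLV : (i j : ℕ) → List (LV i j)
allLV i j = L ∷ R ∷ (map x (allFin i) ++ map y (allFin j))

-- An (i,j)-ladder structure on a graph with vertex set LV i j:
-- its edge set is the union of the edge sets of two graphs E₁, E₂
-- (on subsets of the vertices), where E₁ is an i-rung ladder with struts
-- L,R and rungs x₁..xᵢ, and E₂ is a j-rung ladder with struts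
-- x_{⌊i/2⌋}, x_{⌊i/2⌋+1} and rungs y₁..yⱼ.
record IsLadder (i j : ℕ) (G : Graph (LV i j)) : Set₁ where
  open Graph G
  field
    E₁ E₂   : LV i j → LV i j → Set
    E₁-sym  : ∀ {u v} → E₁ u v → E₁ v u
    E₂-sym  : ∀ {u v} → E₂ u v → E₂ v u
    union   : ∀ u v → Adj u v ⇔ (E₁ u v ⊎ E₂ u v)
    E₁-L    : ∀ k → E₁ L (x k)
    E₁-R    : ∀ k → E₁ (x k) R
    E₁-path : ∀ (k k' : Fin i) → suc (toℕ k) ≡ toℕ k' → Path E₁ (x k) (x k')
    E₂-L    : ∀ (p : Fin i) → suc (toℕ p) ≡ i / 2 → ∀ k → E₂ (x p) (y k)
    E₂-R    : ∀ (q : Fin i) → toℕ q ≡ i / 2 → ∀ k → E₂ (y k) (x q)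
    E₂-path : ∀ (k k' : Fin j) → suc (toℕ k) ≡ toℕ k' → Path E₂ (y k) (y k')

record Rect : Set where
  field
    x₁ x₂ y₁ y₂ : ℤ
    wpos : x₁ ℤ.< x₂
    hpos : y₁ ℤ.< y₂
open Rect

Overlap : ℤ → ℤ → ℤ → ℤ → Set
Overlap a b c d = (a ⊔ c) ℤ.< (b ⊓ d)

InteriorsMeet : Rect → Rect → Set
InteriorsMeet r s = Overlap (x₁ r) (x₂ r) (x₁ s) (x₂ s) × Overlap (y₁ r) (y₂ r) (y₁ s) (y₂ s)

OneOf : ℤ → ℤ → ℤ → Set
OneOf a b c = (a ≡ b) ⊎ (a ≡ c)

ShareSegment : Rect → Rect → Set
ShareSegment r s =
    (Σ ℤ λ t → OneOf t (x₁ r) (x₂ r) × OneOf t (x₁ s) (x₂ s)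
              × Overlap (y₁ r) (y₂ r) (y₁ s) (y₂ s))
  ⊎ (Σ ℤ λ t → OneOf t (y₁ r) (y₂ r) × OneOf t (y₁ s) (y₂ s)
              × Overlap (x₁ r) (x₂ r) (x₁ s) (x₂ s))

record Layout {V : Set} (G : Graph V) : Set where
  open Graph G
  field
    rect     : V → Rect
    disjoint : ∀ u v → u ≢ v → ¬ InteriorsMeet (rect u) (rect v)
    contact  : ∀ u v → u ≢ v → Adj u v ⇔ ShareSegment (rect u) (rect v)

area : ∀ {i j} {G : Graph (LV i j)} → Layout G → ℤ
area {i} {j} Λ = (maxX ℤ.- minX) ℤ.* (maxY ℤ.- minY)
  where
  open Layout Λ
  vs = map rect (allLV i j)
  r0 = rect L
  minX = foldr _⊓_ (x₁ r0) (map x₁ vs)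
  maxX = foldr _⊔_ (x₂ r0) (map x₂ vs)
  minY = foldr _⊓_ (y₁ r0) (map y₁ vs)
  maxY = foldr _⊔_ (y₂ r0) (map y₂ vs)

{-# OPTIONS --safe #-}
-- Every rung of a ladder touches both struts S and T. Sort the rungs by the sides of the
-- rung on which S and T lie (16 classes). If S and T lie left and right of a rung, its
-- x-extent is the gap between them, so two such rungs overlap unless their bottom edges
-- differ; symmetrically for S and T below and above; in every other class any two rungs
-- overlap. By pigeonhole, n disjoint rungs force height ≥ n/16 when no rung has its struts
-- below and above, width ≥ n/16 when none has them left and right, and n ≤ 16 when neither
-- happens. In an (n,n)-ladder the inner struts are outer rungs, hence both span every gap
-- between L and R, so an orientation occurring among the outer rungs cannot occur among
-- the inner ones. The two ladders' bounds then multiply to n² ≤ 256 · area.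

module Submission where

open import Defs
open import Data.Nat using (ℕ; _≤_; _*_)
open import Data.Integer using (+_)
open import Data.Rational using (ℚ; 0ℚ; _<_; _/_)
open import Data.Product using (Σ; _×_)
import Data.Rational as Q

import Data.Nat as ℕ
import Data.Nat.Properties as ℕP
open import Data.Nat.DivMod using (m/n<m; m≥n⇒m/n>0)
open import Data.Nat.Solver using (module +-*-Solver)
open import Data.Integer as ℤ using (ℤ; _⊓_; _⊔_; _-_; ∣_∣)
import Data.Integer.Properties as ℤP
open import Algebra.Properties.AbelianGroup ℤP.+-0-abelianGroup using (∙-cancelʳ)
open import Data.Fin as Fin using (Fin; toℕ; fromℕ<; combine)
import Data.Fin.Properties as FinP
open import Data.Product using (_,_; proj₁; proj₂; curry)
open import Data.Sum using (_⊎_; inj₁; inj₂)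
open import Data.Unit using (⊤; tt)
open import Data.Empty using (⊥)
open import Data.List using (List; _∷_; map; foldr; allFin)
open import Data.List.Membership.Propositional using (_∈_)
open import Data.List.Membership.Propositional.Properties using (∈-map⁺; ∈-++⁺ˡ; ∈-++⁺ʳ; ∈-allFin)
open import Data.List.Relation.Unary.Any using (here; there)
open import Relation.Nullary using (¬_; Dec; yes; no; contradiction)
open import Relation.Binary.PropositionalEquality
open import Function using (_∘_)
open import Function.Bundles using (Equivalence)
import Data.Rational.Properties as QP
import Data.Rational.Unnormalised as Qᵘ
import Data.Rational.Unnormalised.Properties as QᵘP
open import Data.Nat.Coprimality using (1-coprimeTo) renaming (sym to coprime-sym)
open Rect

-- Open integer intervals

<⇒overlap : ∀ {a b c d} → a ℤ.< b → c ℤ.< d → a ℤ.< d → c ℤ.< b → Overlap a b c d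
<⇒overlap {a} {b} {c} {d} a<b c<d a<d c<b with ℤP.⊔-sel a c | ℤP.⊓-sel b d
... | inj₁ a⊔c≡a | inj₁ b⊓d≡b rewrite a⊔c≡a | b⊓d≡b = a<b
... | inj₁ a⊔c≡a | inj₂ b⊓d≡d rewrite a⊔c≡a | b⊓d≡d = a<d
... | inj₂ a⊔c≡c | inj₁ b⊓d≡b rewrite a⊔c≡c | b⊓d≡b = c<b
... | inj₂ a⊔c≡c | inj₂ b⊓d≡d rewrite a⊔c≡c | b⊓d≡d = c<d

overlap⇒< : ∀ {a b c d} → Overlap a b c d → a ℤ.< d × c ℤ.< b
overlap⇒< {a} {b} {c} {d} o =
  ℤP.≤-<-trans (ℤP.i≤i⊔j a c) (ℤP.<-≤-trans o (ℤP.i⊓j≤j b d)) ,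
  ℤP.≤-<-trans (ℤP.i≤j⊔i a c) (ℤP.<-≤-trans o (ℤP.i⊓j≤i b d))

overlap-≡ˡ : ∀ {a b c d} → a ℤ.< b → c ℤ.< d → a ≡ c → Overlap a b c d
overlap-≡ˡ a<b c<d refl = <⇒overlap a<b c<d c<d a<b

overlap-≡ʳ : ∀ {a b c d} → a ℤ.< b → c ℤ.< d → b ≡ d → Overlap a b c d
overlap-≡ʳ a<b c<d refl = <⇒overlap a<b c<d a<b c<d

<-across-gap : ∀ {k₁ k₂ l₁ l₂ u₁ u₂ v₁ v₂} → u₂ ℤ.≤ v₁ →
  Overlap k₁ k₂ u₁ u₂ → Overlap l₁ l₂ v₁ v₂ → k₁ ℤ.< l₂
<-across-gap u₂≤v₁ kU lV =
  ℤP.<-trans (ℤP.<-≤-trans (proj₁ (overlap⇒< kU)) u₂≤v₁) (proj₂ (overlap⇒< lV))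

overlap-across-gap : ∀ {i₁ i₂ j₁ j₂ p₁ p₂ q₁ q₂} →
  i₁ ℤ.< i₂ → j₁ ℤ.< j₂ → p₁ ℤ.< p₂ → q₁ ℤ.< q₂ → ¬ Overlap p₁ p₂ q₁ q₂ →
  Overlap i₁ i₂ p₁ p₂ → Overlap i₁ i₂ q₁ q₂ → Overlap j₁ j₂ p₁ p₂ → Overlap j₁ j₂ q₁ q₂ →
  Overlap i₁ i₂ j₁ j₂
overlap-across-gap {p₁ = p₁} {p₂} {q₁} {q₂} i₁<i₂ j₁<j₂ p₁<p₂ q₁<q₂ P∦Q iP iQ jP jQ
  with p₂ ℤP.≤? q₁
... | yes p₂≤q₁ = <⇒overlap i₁<i₂ j₁<j₂ (<-across-gap p₂≤q₁ iP jQ) (<-across-gap p₂≤q₁ jP iQ)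
... | no  p₂≰q₁ = <⇒overlap i₁<i₂ j₁<j₂ (<-across-gap q₂≤p₁ iQ jP) (<-across-gap q₂≤p₁ jQ iP)
  where
  q₂≤p₁ : q₂ ℤ.≤ p₁
  q₂≤p₁ = ℤP.≮⇒≥ (λ p₁<q₂ → P∦Q (<⇒overlap p₁<p₂ q₁<q₂ p₁<q₂ (ℤP.≰⇒> p₂≰q₁)))

+∣j-i∣≡j-i : ∀ {i j} → i ℤ.≤ j → + ∣ j - i ∣ ≡ j - i
+∣j-i∣≡j-i i≤j = ℤP.0≤i⇒+∣i∣≡i (ℤP.i≤j⇒0≤j-i i≤j)

∣i-m∣≡∣j-m∣⇒i≡j : ∀ {m i j} → m ℤ.≤ i → m ℤ.≤ j → ∣ i - m ∣ ≡ ∣ j - m ∣ → i ≡ j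
∣i-m∣≡∣j-m∣⇒i≡j {m} {i} {j} m≤i m≤j eq = ∙-cancelʳ (ℤ.- m) i j (begin
  i - m       ≡⟨ +∣j-i∣≡j-i m≤i ⟨
  + ∣ i - m ∣ ≡⟨ cong +_ eq ⟩
  + ∣ j - m ∣ ≡⟨ +∣j-i∣≡j-i m≤j ⟩
  j - m       ∎)
  where open ≡-Reasoning

m≤i<j⇒∣i-m∣<∣j-m∣ : ∀ {m i j} → m ℤ.≤ i → i ℤ.< j → ∣ i - m ∣ ℕ.< ∣ j - m ∣
m≤i<j⇒∣i-m∣<∣j-m∣ {m} m≤i i<j = ℤP.drop‿+<+ (subst₂ ℤ._<_
  (sym (+∣j-i∣≡j-i m≤i)) (sym (+∣j-i∣≡j-i (ℤP.<⇒≤ (ℤP.≤-<-trans m≤i i<j))))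
  (ℤP.+-monoˡ-< (ℤ.- m) i<j))

-- Rectangles

OverlapX OverlapY : Rect → Rect → Set
OverlapX r s = Overlap (x₁ r) (x₂ r) (x₁ s) (x₂ s)
OverlapY r s = Overlap (y₁ r) (y₂ r) (y₁ s) (y₂ s)

-- Sides live in Fin 4 so that the pigeonhole principle can count them.
Side : Set
Side = Fin 4

pattern west  = Fin.zero
pattern east  = Fin.suc Fin.zero
pattern south = Fin.suc (Fin.suc Fin.zero)
pattern north = Fin.suc (Fin.suc (Fin.suc Fin.zero))

data Touches (a s : Rect) : Side → Set where
  on-west  : x₁ a ≡ x₂ s → OverlapY a s → Touches a s west
  on-east  : x₂ a ≡ x₁ s → OverlapY a s → Touches a s east
  on-south : y₁ a ≡ y₂ s → OverlapX a s → Touches a s south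
  on-north : y₂ a ≡ y₁ s → OverlapX a s → Touches a s north

shareSegment⇒touches : ∀ r s → ¬ InteriorsMeet r s → ShareSegment r s → Σ Side (Touches r s)
shareSegment⇒touches r s r∦s (inj₁ (_ , inj₁ e₁ , inj₁ e₂ , o)) =
  contradiction (overlap-≡ˡ (wpos r) (wpos s) (trans (sym e₁) e₂) , o) r∦s
shareSegment⇒touches r s r∦s (inj₁ (_ , inj₁ e₁ , inj₂ e₂ , o)) = west , on-west (trans (sym e₁) e₂) o
shareSegment⇒touches r s r∦s (inj₁ (_ , inj₂ e₁ , inj₁ e₂ , o)) = east , on-east (trans (sym e₁) e₂) o
shareSegment⇒touches r s r∦s (inj₁ (_ , inj₂ e₁ , inj₂ e₂ , o)) =
  contradiction (overlap-≡ʳ (wpos r) (wpos s) (trans (sym e₁) e₂) , o) r∦s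
shareSegment⇒touches r s r∦s (inj₂ (_ , inj₁ e₁ , inj₁ e₂ , o)) =
  contradiction (o , overlap-≡ˡ (hpos r) (hpos s) (trans (sym e₁) e₂)) r∦s
shareSegment⇒touches r s r∦s (inj₂ (_ , inj₁ e₁ , inj₂ e₂ , o)) = south , on-south (trans (sym e₁) e₂) o
shareSegment⇒touches r s r∦s (inj₂ (_ , inj₂ e₁ , inj₁ e₂ , o)) = north , on-north (trans (sym e₁) e₂) o
shareSegment⇒touches r s r∦s (inj₂ (_ , inj₂ e₁ , inj₂ e₂ , o)) =
  contradiction (o , overlap-≡ʳ (hpos r) (hpos s) (trans (sym e₁) e₂)) r∦s

touches⇒closures-meetˣ : ∀ {a b d} → Touches a b d → x₁ a ℤ.≤ x₂ b × x₁ b ℤ.≤ x₂ a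
touches⇒closures-meetˣ {a} {b} (on-west e _) =
  ℤP.≤-reflexive e , ℤP.<⇒≤ (ℤP.<-trans (subst (x₁ b ℤ.<_) (sym e) (wpos b)) (wpos a))
touches⇒closures-meetˣ {a} {b} (on-east e _) =
  ℤP.<⇒≤ (ℤP.<-trans (wpos a) (subst (ℤ._< x₂ b) (sym e) (wpos b))) , ℤP.≤-reflexive (sym e)
touches⇒closures-meetˣ (on-south _ o) = ℤP.<⇒≤ (proj₁ (overlap⇒< o)) , ℤP.<⇒≤ (proj₂ (overlap⇒< o))
touches⇒closures-meetˣ (on-north _ o) = ℤP.<⇒≤ (proj₁ (overlap⇒< o)) , ℤP.<⇒≤ (proj₂ (overlap⇒< o))

touches⇒closures-meetʸ : ∀ {a b d} → Touches a b d → y₁ a ℤ.≤ y₂ b × y₁ b ℤ.≤ y₂ a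
touches⇒closures-meetʸ {a} {b} (on-south e _) =
  ℤP.≤-reflexive e , ℤP.<⇒≤ (ℤP.<-trans (subst (y₁ b ℤ.<_) (sym e) (hpos b)) (hpos a))
touches⇒closures-meetʸ {a} {b} (on-north e _) =
  ℤP.<⇒≤ (ℤP.<-trans (hpos a) (subst (ℤ._< y₂ b) (sym e) (hpos b))) , ℤP.≤-reflexive (sym e)
touches⇒closures-meetʸ (on-west _ o) = ℤP.<⇒≤ (proj₁ (overlap⇒< o)) , ℤP.<⇒≤ (proj₂ (overlap⇒< o))
touches⇒closures-meetʸ (on-east _ o) = ℤP.<⇒≤ (proj₁ (overlap⇒< o)) , ℤP.<⇒≤ (proj₂ (overlap⇒< o))

SeparatedX SeparatedY : Rect → Rect → Set
SeparatedX r s = x₂ r ℤ.< x₁ s ⊎ x₂ s ℤ.< x₁ r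
SeparatedY r s = y₂ r ℤ.< y₁ s ⊎ y₂ s ℤ.< y₁ r

gap-crossing : ∀ {s₂ t₁ p₂ q₁} → s₂ ℤ.< t₁ → p₂ ℤ.< q₁ → t₁ ℤ.≤ p₂ → q₁ ℤ.≤ s₂ → ⊥
gap-crossing s<t p<q t≤p q≤s =
  ℤP.<-irrefl refl (ℤP.<-trans s<t (ℤP.≤-<-trans t≤p (ℤP.<-≤-trans p<q q≤s)))

-- P and Q both contain the gap between S and T.
separatedX⇒¬separatedX : ∀ {S T P Q d₁ d₂ d₃ d₄} → SeparatedX S T →
  Touches P S d₁ → Touches P T d₂ → Touches Q S d₃ → Touches Q T d₄ → ¬ SeparatedX P Q
separatedX⇒¬separatedX (inj₁ S◁T) PS PT QS QT (inj₁ P◁Q) =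
  gap-crossing S◁T P◁Q (proj₂ (touches⇒closures-meetˣ PT)) (proj₁ (touches⇒closures-meetˣ QS))
separatedX⇒¬separatedX (inj₁ S◁T) PS PT QS QT (inj₂ Q◁P) =
  gap-crossing S◁T Q◁P (proj₂ (touches⇒closures-meetˣ QT)) (proj₁ (touches⇒closures-meetˣ PS))
separatedX⇒¬separatedX (inj₂ T◁S) PS PT QS QT (inj₁ P◁Q) =
  gap-crossing T◁S P◁Q (proj₂ (touches⇒closures-meetˣ PS)) (proj₁ (touches⇒closures-meetˣ QT))
separatedX⇒¬separatedX (inj₂ T◁S) PS PT QS QT (inj₂ Q◁P) =
  gap-crossing T◁S Q◁P (proj₂ (touches⇒closures-meetˣ QS)) (proj₁ (touches⇒closures-meetˣ PT))

separatedY⇒¬separatedY : ∀ {S T P Q d₁ d₂ d₃ d₄} → SeparatedY S T →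
  Touches P S d₁ → Touches P T d₂ → Touches Q S d₃ → Touches Q T d₄ → ¬ SeparatedY P Q
separatedY⇒¬separatedY (inj₁ S◁T) PS PT QS QT (inj₁ P◁Q) =
  gap-crossing S◁T P◁Q (proj₂ (touches⇒closures-meetʸ PT)) (proj₁ (touches⇒closures-meetʸ QS))
separatedY⇒¬separatedY (inj₁ S◁T) PS PT QS QT (inj₂ Q◁P) =
  gap-crossing S◁T Q◁P (proj₂ (touches⇒closures-meetʸ QT)) (proj₁ (touches⇒closures-meetʸ PS))
separatedY⇒¬separatedY (inj₂ T◁S) PS PT QS QT (inj₁ P◁Q) =
  gap-crossing T◁S P◁Q (proj₂ (touches⇒closures-meetʸ PS)) (proj₁ (touches⇒closures-meetʸ QT))
separatedY⇒¬separatedY (inj₂ T◁S) PS PT QS QT (inj₂ Q◁P) =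
  gap-crossing T◁S Q◁P (proj₂ (touches⇒closures-meetʸ QS)) (proj₁ (touches⇒closures-meetʸ PT))

-- Rungs between two struts

data Horizontal : Side → Side → Set where
  west-east : Horizontal west east
  east-west : Horizontal east west

data Vertical : Side → Side → Set where
  south-north : Vertical south north
  north-south : Vertical north south

data Kind (d₁ d₂ : Side) : Set where
  horizontal : Horizontal d₁ d₂ → Kind d₁ d₂
  vertical   : Vertical d₁ d₂ → Kind d₁ d₂
  other      : ¬ Horizontal d₁ d₂ → ¬ Vertical d₁ d₂ → Kind d₁ d₂

kind : ∀ d₁ d₂ → Kind d₁ d₂
kind west  east  = horizontal west-east
kind east  west  = horizontal east-west
kind south north = vertical south-north
kind north south = vertical north-south
kind west  west  = other (λ ()) (λ ())
kind west  south = other (λ ()) (λ ())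
kind west  north = other (λ ()) (λ ())
kind east  east  = other (λ ()) (λ ())
kind east  south = other (λ ()) (λ ())
kind east  north = other (λ ()) (λ ())
kind south west  = other (λ ()) (λ ())
kind south east  = other (λ ()) (λ ())
kind south south = other (λ ()) (λ ())
kind north west  = other (λ ()) (λ ())
kind north east  = other (λ ()) (λ ())
kind north north = other (λ ()) (λ ())

vertical⇒¬horizontal : ∀ {d₁ d₂} → Vertical d₁ d₂ → ¬ Horizontal d₁ d₂
vertical⇒¬horizontal south-north ()
vertical⇒¬horizontal north-south ()

horizontal? : ∀ d₁ d₂ → Dec (Horizontal d₁ d₂)
horizontal? d₁ d₂ with kind d₁ d₂
... | horizontal h = yes h
... | vertical v   = no (vertical⇒¬horizontal v)
... | other ¬h _   = no ¬h

vertical? : ∀ d₁ d₂ → Dec (Vertical d₁ d₂)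
vertical? d₁ d₂ with kind d₁ d₂
... | horizontal h = no (λ v → vertical⇒¬horizontal v h)
... | vertical v   = yes v
... | other _ ¬v   = no ¬v

horizontal⇒separatedX : ∀ {a S T d₁ d₂} → Horizontal d₁ d₂ →
  Touches a S d₁ → Touches a T d₂ → SeparatedX S T
horizontal⇒separatedX {a} west-east (on-west e _) (on-east f _) = inj₁ (subst₂ ℤ._<_ e f (wpos a))
horizontal⇒separatedX {a} east-west (on-east e _) (on-west f _) = inj₂ (subst₂ ℤ._<_ f e (wpos a))

vertical⇒separatedY : ∀ {a S T d₁ d₂} → Vertical d₁ d₂ →
  Touches a S d₁ → Touches a T d₂ → SeparatedY S T
vertical⇒separatedY {a} south-north (on-south e _) (on-north f _) = inj₁ (subst₂ ℤ._<_ e f (hpos a))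
vertical⇒separatedY {a} north-south (on-north e _) (on-south f _) = inj₂ (subst₂ ℤ._<_ f e (hpos a))

-- Two rungs attached on the same sides overlap as soon as they agree on this coordinate.
Aligned : ∀ {d₁ d₂} → Kind d₁ d₂ → Rect → Rect → Set
Aligned (horizontal _) a b = y₁ a ≡ y₁ b
Aligned (vertical _)   a b = x₁ a ≡ x₁ b
Aligned (other _ _)    _ _ = ⊤

module _ {S T : Rect} (S∦T : ¬ InteriorsMeet S T) where

  aligned⇒overlapX : ∀ {a b d₁ d₂} → Touches a S d₁ → Touches a T d₂ →
    Touches b S d₁ → Touches b T d₂ → Aligned (kind d₁ d₂) a b → OverlapX a b
  aligned⇒overlapX {a} {b} (on-west e _) _ (on-west e′ _) _ _ =
    overlap-≡ˡ (wpos a) (wpos b) (trans e (sym e′))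
  aligned⇒overlapX {a} {b} (on-east e _) _ (on-east e′ _) _ _ =
    overlap-≡ʳ (wpos a) (wpos b) (trans e (sym e′))
  aligned⇒overlapX {a} {b} (on-south _ _) (on-west e _) (on-south _ _) (on-west e′ _) _ =
    overlap-≡ˡ (wpos a) (wpos b) (trans e (sym e′))
  aligned⇒overlapX {a} {b} (on-north _ _) (on-west e _) (on-north _ _) (on-west e′ _) _ =
    overlap-≡ˡ (wpos a) (wpos b) (trans e (sym e′))
  aligned⇒overlapX {a} {b} (on-south _ _) (on-east e _) (on-south _ _) (on-east e′ _) _ =
    overlap-≡ʳ (wpos a) (wpos b) (trans e (sym e′))
  aligned⇒overlapX {a} {b} (on-north _ _) (on-east e _) (on-north _ _) (on-east e′ _) _ =
    overlap-≡ʳ (wpos a) (wpos b) (trans e (sym e′))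
  aligned⇒overlapX {a} {b} (on-south e aS) (on-south f aT) (on-south _ bS) (on-south _ bT) _ =
    overlap-across-gap (wpos a) (wpos b) (wpos S) (wpos T)
      (λ oX → S∦T (oX , overlap-≡ʳ (hpos S) (hpos T) (trans (sym e) f))) aS aT bS bT
  aligned⇒overlapX {a} {b} (on-north e aS) (on-north f aT) (on-north _ bS) (on-north _ bT) _ =
    overlap-across-gap (wpos a) (wpos b) (wpos S) (wpos T)
      (λ oX → S∦T (oX , overlap-≡ˡ (hpos S) (hpos T) (trans (sym e) f))) aS aT bS bT
  aligned⇒overlapX {a} {b} (on-south _ _) (on-north _ _) (on-south _ _) (on-north _ _) x₁≡ =
    overlap-≡ˡ (wpos a) (wpos b) x₁≡
  aligned⇒overlapX {a} {b} (on-north _ _) (on-south _ _) (on-north _ _) (on-south _ _) x₁≡ =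
    overlap-≡ˡ (wpos a) (wpos b) x₁≡

  aligned⇒overlapY : ∀ {a b d₁ d₂} → Touches a S d₁ → Touches a T d₂ →
    Touches b S d₁ → Touches b T d₂ → Aligned (kind d₁ d₂) a b → OverlapY a b
  aligned⇒overlapY {a} {b} (on-south e _) _ (on-south e′ _) _ _ =
    overlap-≡ˡ (hpos a) (hpos b) (trans e (sym e′))
  aligned⇒overlapY {a} {b} (on-north e _) _ (on-north e′ _) _ _ =
    overlap-≡ʳ (hpos a) (hpos b) (trans e (sym e′))
  aligned⇒overlapY {a} {b} (on-west _ _) (on-south e _) (on-west _ _) (on-south e′ _) _ =
    overlap-≡ˡ (hpos a) (hpos b) (trans e (sym e′))
  aligned⇒overlapY {a} {b} (on-east _ _) (on-south e _) (on-east _ _) (on-south e′ _) _ =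
    overlap-≡ˡ (hpos a) (hpos b) (trans e (sym e′))
  aligned⇒overlapY {a} {b} (on-west _ _) (on-north e _) (on-west _ _) (on-north e′ _) _ =
    overlap-≡ʳ (hpos a) (hpos b) (trans e (sym e′))
  aligned⇒overlapY {a} {b} (on-east _ _) (on-north e _) (on-east _ _) (on-north e′ _) _ =
    overlap-≡ʳ (hpos a) (hpos b) (trans e (sym e′))
  aligned⇒overlapY {a} {b} (on-west e aS) (on-west f aT) (on-west _ bS) (on-west _ bT) _ =
    overlap-across-gap (hpos a) (hpos b) (hpos S) (hpos T)
      (λ oY → S∦T (overlap-≡ʳ (wpos S) (wpos T) (trans (sym e) f) , oY)) aS aT bS bT
  aligned⇒overlapY {a} {b} (on-east e aS) (on-east f aT) (on-east _ bS) (on-east _ bT) _ =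
    overlap-across-gap (hpos a) (hpos b) (hpos S) (hpos T)
      (λ oY → S∦T (overlap-≡ˡ (wpos S) (wpos T) (trans (sym e) f) , oY)) aS aT bS bT
  aligned⇒overlapY {a} {b} (on-west _ _) (on-east _ _) (on-west _ _) (on-east _ _) y₁≡ =
    overlap-≡ˡ (hpos a) (hpos b) y₁≡
  aligned⇒overlapY {a} {b} (on-east _ _) (on-west _ _) (on-east _ _) (on-west _ _) y₁≡ =
    overlap-≡ˡ (hpos a) (hpos b) y₁≡

record _⊆_ (a box : Rect) : Set where
  field
    left   : x₁ box ℤ.≤ x₁ a
    right  : x₂ a ℤ.≤ x₂ box
    bottom : y₁ box ℤ.≤ y₁ a
    top    : y₂ a ℤ.≤ y₂ box
open _⊆_

width height : Rect → ℕ
width  r = ∣ x₂ r - x₁ r ∣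
height r = ∣ y₂ r - y₁ r ∣

∣x₁-x₁∣<width : ∀ {a box} → a ⊆ box → ∣ x₁ a - x₁ box ∣ ℕ.< width box
∣x₁-x₁∣<width {a} a⊆ = m≤i<j⇒∣i-m∣<∣j-m∣ (left a⊆) (ℤP.<-≤-trans (wpos a) (right a⊆))

∣y₁-y₁∣<height : ∀ {a box} → a ⊆ box → ∣ y₁ a - y₁ box ∣ ℕ.< height box
∣y₁-y₁∣<height {a} a⊆ = m≤i<j⇒∣i-m∣<∣j-m∣ (bottom a⊆) (ℤP.<-≤-trans (hpos a) (top a⊆))

-- Position of a rung inside the box along the axis its kind leaves free.
offset : ∀ {d₁ d₂} → Rect → Kind d₁ d₂ → Rect → ℕ
offset box (horizontal _) a = ∣ y₁ a - y₁ box ∣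
offset box (vertical _)   a = ∣ x₁ a - x₁ box ∣
offset box (other _ _)    a = 0

offset-injective : ∀ {d₁ d₂ a b box} (k : Kind d₁ d₂) → a ⊆ box → b ⊆ box →
  offset box k a ≡ offset box k b → Aligned k a b
offset-injective (horizontal _) a⊆ b⊆ eq = ∣i-m∣≡∣j-m∣⇒i≡j (bottom a⊆) (bottom b⊆) eq
offset-injective (vertical _)   a⊆ b⊆ eq = ∣i-m∣≡∣j-m∣⇒i≡j (left a⊆) (left b⊆) eq
offset-injective (other _ _)    _  _  _  = tt

offset<height : ∀ {d₁ d₂ a box} (k : Kind d₁ d₂) → ¬ Vertical d₁ d₂ → a ⊆ box →
  offset box k a ℕ.< height box
offset<height (horizontal _) _  a⊆ = ∣y₁-y₁∣<height a⊆
offset<height (vertical v)   ¬v _  = contradiction v ¬v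
offset<height (other _ _)    _  a⊆ = ℕP.≤-<-trans ℕ.z≤n (∣y₁-y₁∣<height a⊆)

offset<width : ∀ {d₁ d₂ a box} (k : Kind d₁ d₂) → ¬ Horizontal d₁ d₂ → a ⊆ box →
  offset box k a ℕ.< width box
offset<width (horizontal h) ¬h _  = contradiction h ¬h
offset<width (vertical _)   _  a⊆ = ∣x₁-x₁∣<width a⊆
offset<width (other _ _)    _  a⊆ = ℕP.≤-<-trans ℕ.z≤n (∣x₁-x₁∣<width a⊆)

offset<1 : ∀ {d₁ d₂ a box} (k : Kind d₁ d₂) → ¬ Horizontal d₁ d₂ → ¬ Vertical d₁ d₂ →
  offset box k a ℕ.< 1
offset<1 (horizontal h) ¬h _  = contradiction h ¬h
offset<1 (vertical v)   _  ¬v = contradiction v ¬v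
offset<1 (other _ _)    _  _  = ℕ.z<s

same-signature⇒meet : ∀ {S T a b box d₁ d₂ d₁′ d₂′} → ¬ InteriorsMeet S T →
  Touches a S d₁ → Touches a T d₂ → Touches b S d₁′ → Touches b T d₂′ → a ⊆ box → b ⊆ box →
  d₁ ≡ d₁′ → d₂ ≡ d₂′ → offset box (kind d₁ d₂) a ≡ offset box (kind d₁′ d₂′) b →
  InteriorsMeet a b
same-signature⇒meet {a = a} {b} {d₁ = d₁} {d₂} S∦T aS aT bS bT a⊆ b⊆ refl refl eq =
  aligned⇒overlapX S∦T aS aT bS bT aligned , aligned⇒overlapY S∦T aS aT bS bT aligned
  where
  aligned : Aligned (kind d₁ d₂) a b
  aligned = offset-injective (kind d₁ d₂) a⊆ b⊆ eq

record RungLayout (n : ℕ) (box : Rect) : Set where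
  field
    S T          : Rect
    rung         : Fin n → Rect
    struts-apart : ¬ InteriorsMeet S T
    rungs-apart  : ∀ i j → i ≢ j → ¬ InteriorsMeet (rung i) (rung j)
    rung⊆box     : ∀ i → rung i ⊆ box
    attachS      : ∀ i → Σ Side (Touches (rung i) S)
    attachT      : ∀ i → Σ Side (Touches (rung i) T)

  sideS sideT : Fin n → Side
  sideS i = proj₁ (attachS i)
  sideT i = proj₁ (attachT i)

  touchesS : ∀ i → Touches (rung i) S (sideS i)
  touchesS i = proj₂ (attachS i)

  touchesT : ∀ i → Touches (rung i) T (sideT i)
  touchesT i = proj₂ (attachT i)

  rungOffset : Fin n → ℕ
  rungOffset i = offset box (kind (sideS i) (sideT i)) (rung i)

  rungs≤ : ∀ B → (∀ i → rungOffset i ℕ.< B) → n ≤ 16 * B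
  rungs≤ B offset<B = ℕP.≮⇒≥ λ 16B<n →
    let i , j , i<j , eq = FinP.pigeonhole (subst (ℕ._< n) (ℕP.*-assoc 4 4 B) 16B<n) signature
    in  rungs-apart i j (FinP.<⇒≢ i<j) (signature-injective i j eq)
    where
    signature : Fin n → Fin (4 * (4 * B))
    signature i = combine (sideS i) (combine (sideT i) (fromℕ< (offset<B i)))

    signature-injective : ∀ i j → signature i ≡ signature j → InteriorsMeet (rung i) (rung j)
    signature-injective i j eq =
      let eqS , eq′ = FinP.combine-injective _ _ _ _ eq
          eqT , eqO = FinP.combine-injective _ _ _ _ eq′
      in  same-signature⇒meet struts-apart (touchesS i) (touchesT i) (touchesS j) (touchesT j)
            (rung⊆box i) (rung⊆box j) eqS eqT (FinP.fromℕ<-injective _ _ (offset<B i) (offset<B j) eqO)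

  rungs≤16*height : (∀ i → ¬ Vertical (sideS i) (sideT i)) → n ≤ 16 * height box
  rungs≤16*height ¬vertical =
    rungs≤ (height box) (λ i → offset<height (kind _ _) (¬vertical i) (rung⊆box i))

  rungs≤16*width : (∀ i → ¬ Horizontal (sideS i) (sideT i)) → n ≤ 16 * width box
  rungs≤16*width ¬horizontal =
    rungs≤ (width box) (λ i → offset<width (kind _ _) (¬horizontal i) (rung⊆box i))

  rungs≤16 : (∀ i → ¬ Horizontal (sideS i) (sideT i)) →
    (∀ i → ¬ Vertical (sideS i) (sideT i)) → n ≤ 16
  rungs≤16 ¬horizontal ¬vertical =
    rungs≤ 1 (λ i → offset<1 (kind _ _) (¬horizontal i) (¬vertical i))

  horizontal⇒¬separatedX : ∀ {i P Q d₁ d₂ d₃ d₄} → Horizontal (sideS i) (sideT i) →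
    Touches P S d₁ → Touches P T d₂ → Touches Q S d₃ → Touches Q T d₄ → ¬ SeparatedX P Q
  horizontal⇒¬separatedX {i} h =
    separatedX⇒¬separatedX (horizontal⇒separatedX h (touchesS i) (touchesT i))

  vertical⇒¬separatedY : ∀ {i P Q d₁ d₂ d₃ d₄} → Vertical (sideS i) (sideT i) →
    Touches P S d₁ → Touches P T d₂ → Touches Q S d₃ → Touches Q T d₄ → ¬ SeparatedY P Q
  vertical⇒¬separatedY {i} v =
    separatedY⇒¬separatedY (vertical⇒separatedY v (touchesS i) (touchesT i))

-- Layouts of ladders

foldr-⊓-≤ : ∀ z {u} {zs : List ℤ} → u ∈ zs → foldr _⊓_ z zs ℤ.≤ u
foldr-⊓-≤ z {zs = v ∷ _} (here refl) = ℤP.i⊓j≤i v _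
foldr-⊓-≤ z {zs = v ∷ _} (there u∈) = ℤP.≤-trans (ℤP.i⊓j≤j v _) (foldr-⊓-≤ z u∈)

≤-foldr-⊔ : ∀ z {u} {zs : List ℤ} → u ∈ zs → u ℤ.≤ foldr _⊔_ z zs
≤-foldr-⊔ z {zs = v ∷ _} (here refl) = ℤP.i≤i⊔j v _
≤-foldr-⊔ z {zs = v ∷ _} (there u∈) = ℤP.≤-trans (≤-foldr-⊔ z u∈) (ℤP.i≤j⊔i v _)

∈-allLV : ∀ {i j} (v : LV i j) → v ∈ allLV i j
∈-allLV L     = here refl
∈-allLV R     = there (here refl)
∈-allLV (x k) = there (there (∈-++⁺ˡ (∈-map⁺ x (∈-allFin k))))
∈-allLV {i} (y k) = there (there (∈-++⁺ʳ (map x (allFin i)) (∈-map⁺ y (∈-allFin k))))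

x-injective : ∀ {i j} {k k′ : Fin i} → x {i} {j} k ≡ x k′ → k ≡ k′
x-injective refl = refl

y-injective : ∀ {i j} {k k′ : Fin j} → y {i} {j} k ≡ y k′ → k ≡ k′
y-injective refl = refl

[x₂-x₁]*[y₂-y₁]≡width*height : ∀ r → (x₂ r - x₁ r) ℤ.* (y₂ r - y₁ r) ≡ + (width r * height r)
[x₂-x₁]*[y₂-y₁]≡width*height r = begin
  (x₂ r - x₁ r) ℤ.* (y₂ r - y₁ r)
    ≡⟨ cong₂ ℤ._*_ (+∣j-i∣≡j-i (ℤP.<⇒≤ (wpos r))) (+∣j-i∣≡j-i (ℤP.<⇒≤ (hpos r))) ⟨
  + width r ℤ.* + height r
    ≡⟨ ℤP.pos-* (width r) (height r) ⟨
  + (width r * height r)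
    ∎
  where open ≡-Reasoning

module BoundingBox {i j} {G : Graph (LV i j)} (Λ : Layout G) where
  open Layout Λ

  private
    coordinate∈ : (f : Rect → ℤ) (v : LV i j) → f (rect v) ∈ map f (map rect (allLV i j))
    coordinate∈ f v = ∈-map⁺ f (∈-map⁺ rect (∈-allLV v))

    lowest : (Rect → ℤ) → ℤ
    lowest f = foldr _⊓_ (f (rect L)) (map f (map rect (allLV i j)))

    highest : (Rect → ℤ) → ℤ
    highest f = foldr _⊔_ (f (rect L)) (map f (map rect (allLV i j)))

    lowest≤ : ∀ f v → lowest f ℤ.≤ f (rect v)
    lowest≤ f v = foldr-⊓-≤ _ (coordinate∈ f v)

    ≤highest : ∀ f v → f (rect v) ℤ.≤ highest f
    ≤highest f v = ≤-foldr-⊔ _ (coordinate∈ f v)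

  box : Rect
  box = record
    { x₁ = lowest x₁ ; x₂ = highest x₂ ; y₁ = lowest y₁ ; y₂ = highest y₂
    ; wpos = ℤP.≤-<-trans (lowest≤ x₁ L) (ℤP.<-≤-trans (wpos (rect L)) (≤highest x₂ L))
    ; hpos = ℤP.≤-<-trans (lowest≤ y₁ L) (ℤP.<-≤-trans (hpos (rect L)) (≤highest y₂ L))
    }

  rect⊆box : ∀ v → rect v ⊆ box
  rect⊆box v = record
    { left = lowest≤ x₁ v ; right = ≤highest x₂ v ; bottom = lowest≤ y₁ v ; top = ≤highest y₂ v }

  area≡ : area Λ ≡ + (width box * height box)
  area≡ = [x₂-x₁]*[y₂-y₁]≡width*height box

width>0 : ∀ r → width r ℕ.> 0
width>0 r = ℕP.≤-<-trans ℕ.z≤n (m≤i<j⇒∣i-m∣<∣j-m∣ ℤP.≤-refl (wpos r))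

height>0 : ∀ r → height r ℕ.> 0
height>0 r = ℕP.≤-<-trans ℕ.z≤n (m≤i<j⇒∣i-m∣<∣j-m∣ ℤP.≤-refl (hpos r))

square-bound : ∀ {n W H} → 1 ≤ W → 1 ≤ H →
  n ≤ 16 ⊎ (n ≤ 16 * H × n ≤ 16 * W) → n * n ≤ 256 * (W * H)
square-bound 1≤W 1≤H (inj₁ n≤16) =
  ℕP.≤-trans (ℕP.*-mono-≤ n≤16 n≤16) (ℕP.*-monoʳ-≤ 256 (ℕP.*-mono-≤ 1≤W 1≤H))
square-bound {W = W} {H} _ _ (inj₂ (n≤16H , n≤16W)) =
  ℕP.≤-trans (ℕP.*-mono-≤ n≤16H n≤16W) (ℕP.≤-reflexive (rearrange H W))
  where
  open +-*-Solver
  rearrange : ∀ H W → (16 * H) * (16 * W) ≡ 256 * (W * H)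
  rearrange = solve 2 (λ H W → (con 16 :* H) :* (con 16 :* W) := con 256 :* (W :* H)) refl

module LadderLayout {n} {G : Graph (LV n n)} (2≤n : 2 ≤ n) (ladder : IsLadder n n G) (Λ : Layout G)
  where
  open IsLadder ladder
  open Layout Λ
  open BoundingBox Λ

  attach : ∀ {u v} → u ≢ v → E₁ u v ⊎ E₂ u v → Σ Side (Touches (rect u) (rect v))
  attach {u} {v} u≢v e = shareSegment⇒touches (rect u) (rect v) (disjoint u v u≢v)
    (Equivalence.to (contact u v u≢v) (Equivalence.from (union u v) e))

  private
    instance
      n≢0 : ℕ.NonZero n
      n≢0 = ℕ.>-nonZero (ℕP.≤-trans (ℕ.s≤s ℕ.z≤n) 2≤n)
      half≢0 : ℕ.NonZero (n ℕ./ 2)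
      half≢0 = ℕ.>-nonZero (m≥n⇒m/n>0 2≤n)

    half<n : n ℕ./ 2 ℕ.< n
    half<n = m/n<m n 2 (ℕ.s≤s (ℕ.s≤s ℕ.z≤n))

    pred-half<n : ℕ.pred (n ℕ./ 2) ℕ.< n
    pred-half<n = ℕP.≤-<-trans ℕP.pred[n]≤n half<n

  p q : Fin n
  p = fromℕ< pred-half<n
  q = fromℕ< half<n

  p-spec : ℕ.suc (toℕ p) ≡ n ℕ./ 2
  p-spec = trans (cong ℕ.suc (FinP.toℕ-fromℕ< pred-half<n)) (ℕP.suc-pred (n ℕ./ 2))

  q-spec : toℕ q ≡ n ℕ./ 2
  q-spec = FinP.toℕ-fromℕ< half<n

  xp≢xq : x {n} {n} p ≢ x q
  xp≢xq xp≡xq = ℕP.1+n≢n (trans (trans p-spec (sym q-spec)) (cong toℕ (sym (x-injective xp≡xq))))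

  outer : RungLayout n box
  outer = record
    { S = rect L ; T = rect R ; rung = rect ∘ x
    ; struts-apart = disjoint L R (λ ())
    ; rungs-apart  = λ k k′ k≢k′ → disjoint (x k) (x k′) (k≢k′ ∘ x-injective)
    ; rung⊆box     = rect⊆box ∘ x
    ; attachS      = λ k → attach (λ ()) (inj₁ (E₁-sym (E₁-L k)))
    ; attachT      = λ k → attach (λ ()) (inj₁ (E₁-R k))
    }

  inner : RungLayout n box
  inner = record
    { S = rect (x p) ; T = rect (x q) ; rung = rect ∘ y
    ; struts-apart = disjoint (x p) (x q) xp≢xq
    ; rungs-apart  = λ k k′ k≢k′ → disjoint (y k) (y k′) (k≢k′ ∘ y-injective)
    ; rung⊆box     = rect⊆box ∘ y
    ; attachS      = λ k → attach (λ ()) (inj₂ (E₂-sym (E₂-L p p-spec k)))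
    ; attachT      = λ k → attach (λ ()) (inj₂ (E₂-R q q-spec k))
    }

  module Outer = RungLayout outer
  module Inner = RungLayout inner

  -- The struts of the inner ladder are rungs of the outer one.
  ¬both-horizontal : ∀ {k} → Horizontal (Outer.sideS k) (Outer.sideT k) →
    ∀ k′ → ¬ Horizontal (Inner.sideS k′) (Inner.sideT k′)
  ¬both-horizontal h k′ h′ =
    Outer.horizontal⇒¬separatedX h
      (Outer.touchesS p) (Outer.touchesT p) (Outer.touchesS q) (Outer.touchesT q)
      (horizontal⇒separatedX h′ (Inner.touchesS k′) (Inner.touchesT k′))

  ¬both-vertical : ∀ {k} → Vertical (Outer.sideS k) (Outer.sideT k) →
    ∀ k′ → ¬ Vertical (Inner.sideS k′) (Inner.sideT k′)
  ¬both-vertical v k′ v′ =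
    Outer.vertical⇒¬separatedY v
      (Outer.touchesS p) (Outer.touchesT p) (Outer.touchesS q) (Outer.touchesT q)
      (vertical⇒separatedY v′ (Inner.touchesS k′) (Inner.touchesT k′))

  rungs-bound : n ≤ 16 ⊎ (n ≤ 16 * height box × n ≤ 16 * width box)
  rungs-bound with FinP.any? (λ k → vertical? (Outer.sideS k) (Outer.sideT k))
                 | FinP.any? (λ k → horizontal? (Inner.sideS k) (Inner.sideT k))
  ... | no ¬vO | no ¬hI = inj₂ (Outer.rungs≤16*height (curry ¬vO) , Inner.rungs≤16*width (curry ¬hI))
  ... | no ¬vO | yes (_ , h′) = inj₁ (Outer.rungs≤16 (λ _ h → ¬both-horizontal h _ h′) (curry ¬vO))
  ... | yes (_ , v) | _ with FinP.any? (λ k → horizontal? (Outer.sideS k) (Outer.sideT k))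
  ...   | no ¬hO      = inj₂ (Inner.rungs≤16*height (¬both-vertical v) , Outer.rungs≤16*width (curry ¬hO))
  ...   | yes (_ , h) = inj₁ (Inner.rungs≤16 (¬both-horizontal h) (¬both-vertical v))

  area-bound : n * n ≤ 256 * (width box * height box)
  area-bound = square-bound (width>0 box) (height>0 box) rungs-bound

+m/1≡mkℚ : ∀ m → + m / 1 ≡ Q.mkℚ (+ m) 0 (coprime-sym (1-coprimeTo m))
+m/1≡mkℚ m = QP.normalize-coprime (coprime-sym (1-coprimeTo m))

N≤256*A⇒N/256≤A : ∀ {N A} → N ≤ 256 * A → (+ 1 / 256) Q.* (+ N / 1) Q.≤ (+ A / 1)
N≤256*A⇒N/256≤A {N} {A} N≤256A rewrite +m/1≡mkℚ N | +m/1≡mkℚ A =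
  QP.toℚᵘ-cancel-≤ (QᵘP.≤-respˡ-≃
    (QᵘP.≃-sym (QP.toℚᵘ-homo-* (+ 1 / 256) (Q.mkℚ (+ N) 0 (coprime-sym (1-coprimeTo N)))))
    (Qᵘ.*≤* (begin
      (+ 1 ℤ.* + N) ℤ.* + 1   ≡⟨ ℤP.*-identityʳ _ ⟩
      + 1 ℤ.* + N             ≡⟨ ℤP.*-identityˡ _ ⟩
      + N                     ≤⟨ ℤ.+≤+ (subst (N ≤_) (ℕP.*-comm 256 A) N≤256A) ⟩
      + (A * 256)             ≡⟨ ℤP.pos-* A 256 ⟩
      + A ℤ.* + 256           ≡⟨ cong (+ A ℤ.*_) (ℤP.*-identityʳ _) ⟨
      + A ℤ.* (+ 256 ℤ.* + 1) ∎)))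
  where open ℤP.≤-Reasoning

theorem5 : Σ ℚ λ c → (0ℚ < c) ×
    (∀ (n : ℕ) → 4 ≤ n → (G : Graph (LV n n)) → IsLadder n n G →
      (Λ : Layout G) → c Q.* ((+ (n * n)) / 1) Q.≤ (area Λ / 1))
theorem5 = + 1 / 256 , Q.*<* (ℤ.+<+ ℕ.z<s) , bound
  where
  bound : ∀ n → 4 ≤ n → (G : Graph (LV n n)) → IsLadder n n G →
    (Λ : Layout G) → + 1 / 256 Q.* (+ (n * n) / 1) Q.≤ area Λ / 1
  bound n 4≤n G ladder Λ =
    subst (λ a → + 1 / 256 Q.* (+ (n * n) / 1) Q.≤ a / 1) (sym area≡)
      (N≤256*A⇒N/256≤A {A = width box * height box} area-bound)
    where
    open BoundingBox Λ
    open LadderLayout (ℕP.≤-trans (ℕ.s≤s (ℕ.s≤s ℕ.z≤n)) 4≤n) ladder Λ
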